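{- If $A=(a'_1,\ldots,a'_s)$, then $\operatorname{gon}(B_{A;n})\leq \operatorname{lcm}(a'_1,\ldots,a'_s)$.
   Context: For a sequence $A=(a'_1,\ldots,a'_s)$ of positive integers and $n\geq 0$, $B_{A;n}$ (an $A$-monoculture banana path) is the multigraph on vertices $v_0,\ldots,v_n$ where $v_{i-1}$ and $v_i$ are joined by $a_i$ parallel edges, with $a_i=a'_j$ for the $j\in\{1,\ldots,s\}$ congruent to $i$ modulo $s$, and no other edges. $\operatorname{gon}$ denotes the divisorial gonality, the minimum degree of a divisor of positive rank in the chip-firing (Baker–Norine) divisor theory. -}

module Defs where

open import Data.Nat as ℕ using (ℕ; zero; suc; NonZero)
open import Data.Nat.LCM using (lcm)
open import Data.Nat.DivMod using (_mod_)
open import Data.Fin using (Fin; toℕ)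
open import Data.Integer as ℤ using (ℤ; +_; _-_; _*_)
open import Data.Product using (Σ; ∃; _×_; _,_)
open import Relation.Binary.PropositionalEquality using (_≡_)
open import Relation.Nullary using (yes; no)

record Multigraph : Set where
  field
    N    : ℕ
    mult : Fin N → Fin N → ℕ
open Multigraph public

∑ : {n : ℕ} → (Fin n → ℤ) → ℤ
∑ {zero}  f = + 0
∑ {suc n} f = f Fin.zero ℤ.+ ∑ (λ i → f (Fin.suc i))
  where import Data.Fin as Fin

Divisor : Multigraph → Set
Divisor G = Fin (N G) → ℤ

deg : {G : Multigraph} → Divisor G → ℤ
deg D = ∑ D

Effective : {G : Multigraph} → Divisor G → Set
Effective D = ∀ v → + 0 ℤ.≤ D v

laplacian : (G : Multigraph) → (Fin (N G) → ℤ) → Divisor G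
laplacian G f v = ∑ (λ w → + mult G v w * (f v - f w))

_∼_ : {G : Multigraph} → Divisor G → Divisor G → Set
_∼_ {G} D D' = ∃ λ (f : Fin (N G) → ℤ) → ∀ v → D' v ≡ D v - laplacian G f v

-- Baker–Norine: r(D) ≥ k  iff  for every effective E of degree ≤ k, D - E is
-- linearly equivalent to an effective divisor.
RankAtLeast : (G : Multigraph) → ℕ → Divisor G → Set
RankAtLeast G k D =
  (E : Divisor G) → Effective {G} E → deg {G} E ℤ.≤ + k →
  ∃ λ (D' : Divisor G) → _∼_ {G} (λ v → D v - E v) D' × Effective {G} D'

-- gon(G) ≤ k : some divisor of positive rank has degree ≤ k
-- (unfolding of "the minimum degree of a divisor of positive rank is ≤ k")
GonalityAtMost : Multigraph → ℕ → Set
GonalityAtMost G k = ∃ λ (D : Divisor G) → deg {G} D ℤ.≤ + k × RankAtLeast G 1 D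

-- banana path B_{A;n}: vertices v_0..v_n (Fin (suc n)); v_k and v_{k+1} joined by
-- a_{k+1} = A (k mod s) edges (0-based index into A), no other edges.
bananaMult : (s : ℕ) .{{_ : NonZero s}} → (Fin s → ℕ) → (n : ℕ) →
             Fin (suc n) → Fin (suc n) → ℕ
bananaMult s A n u w with toℕ w ℕ.≟ suc (toℕ u) | toℕ u ℕ.≟ suc (toℕ w)
... | yes _ | _     = A (toℕ u mod s)
... | no _  | yes _ = A (toℕ w mod s)
... | no _  | no _  = 0

banana : (s : ℕ) .{{_ : NonZero s}} → (Fin s → ℕ) → ℕ → Multigraph
banana s A n = record { N = suc n ; mult = bananaMult s A n }

lcmAll : {s : ℕ} → (Fin s → ℕ) → ℕ
lcmAll {zero}  A = 1
lcmAll {suc s} A = lcm (A Fin.zero) (lcmAll (λ i → A (Fin.suc i)))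
  where import Data.Fin as Fin

{-# OPTIONS --safe #-}
module Submission where

-- Let L = lcm(a'₁, …, a'ₛ) and put L chips on v₀. Firing each of v₀, …, v_j exactly
-- L / a_{j+1} times moves chips only across the a_{j+1} edges between v_j and v_{j+1}, so it
-- carries all L chips from v_j to v_{j+1}; hence L·v₀ ∼ L·v_k for every k. An effective
-- divisor E of degree ≤ 1 is 0 or a single chip on some v_k, and since L ≥ 1 the divisor
-- L·v_k − E is effective, so L·v₀ has rank ≥ 1.

open import Defs
open import Data.Bool using (if_then_else_)
open import Data.Nat as ℕ using (ℕ; NonZero; _<_; zero; suc)
open import Data.Nat.DivMod using (_mod_)
import Data.Nat.Properties as ℕP
open import Data.Nat.LCM using (lcm; m∣lcm[m,n]; n∣lcm[m,n]; gcd*lcm)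
open import Data.Nat.GCD using (gcd)
open import Data.Nat.Divisibility using (_∣_; ∣-trans; quotient; m∣n⇒n≡quotient*m)
open import Data.Fin as Fin using (Fin; toℕ; fromℕ<)
import Data.Fin.Properties as FinP
open import Data.Integer as ℤ using (ℤ; +_; -_; _+_; _-_; _*_; +≤+)
import Data.Integer.Properties as ℤP
open import Data.Integer.Tactic.RingSolver using (solve-∀)
open import Algebra.Properties.CommutativeSemigroup ℤP.+-commutativeSemigroup using (interchange)
open import Data.Product using (∃; _×_; _,_)
open import Data.Sum using (_⊎_; inj₁; inj₂; [_,_]′)
open import Function using (_∘_; id)
open import Relation.Nullary using (¬_; yes; no; does; contradiction)
open import Relation.Nullary.Decidable using (dec-true; dec-false)
open import Relation.Binary.PropositionalEquality

∑-cong : ∀ {m} {g h : Fin m → ℤ} → (∀ w → g w ≡ h w) → ∑ g ≡ ∑ h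
∑-cong {zero}  g≗h = refl
∑-cong {suc m} g≗h = cong₂ _+_ (g≗h Fin.zero) (∑-cong (g≗h ∘ Fin.suc))

∑-zero : ∀ {m} {g : Fin m → ℤ} → (∀ w → g w ≡ + 0) → ∑ g ≡ + 0
∑-zero {zero}  g≗0 = refl
∑-zero {suc m} g≗0 = cong₂ _+_ (g≗0 Fin.zero) (∑-zero (g≗0 ∘ Fin.suc))

∑-+ : ∀ {m} (g h : Fin m → ℤ) → ∑ (λ w → g w + h w) ≡ ∑ g + ∑ h
∑-+ {zero}  g h = refl
∑-+ {suc m} g h =
  trans (cong (_+_ (g Fin.zero + h Fin.zero)) (∑-+ (g ∘ Fin.suc) (h ∘ Fin.suc)))
        (interchange (g Fin.zero) (h Fin.zero) (∑ (g ∘ Fin.suc)) (∑ (h ∘ Fin.suc)))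

∑-single : ∀ {m} (g : Fin m → ℤ) k → (∀ w → w ≢ k → g w ≡ + 0) → ∑ g ≡ g k
∑-single {suc m} g Fin.zero g≗0 =
  trans (cong (_+_ (g Fin.zero)) (∑-zero (λ w → g≗0 (Fin.suc w) λ ())))
        (ℤP.+-identityʳ _)
∑-single {suc m} g (Fin.suc k) g≗0 =
  trans (cong₂ _+_ (g≗0 Fin.zero λ ())
                   (∑-single (g ∘ Fin.suc) k (λ w w≢k → g≗0 (Fin.suc w) (w≢k ∘ FinP.suc-injective))))
        (ℤP.+-identityˡ _)

∑-nonneg : ∀ {m} (E : Fin m → ℤ) → (∀ v → + 0 ℤ.≤ E v) → + 0 ℤ.≤ ∑ E
∑-nonneg {zero}  E E≥0 = +≤+ ℕ.z≤n
∑-nonneg {suc m} E E≥0 = ℤP.+-mono-≤ (E≥0 Fin.zero) (∑-nonneg (E ∘ Fin.suc) (E≥0 ∘ Fin.suc))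

term≤∑ : ∀ {m} (E : Fin m → ℤ) → (∀ v → + 0 ℤ.≤ E v) → ∀ k → E k ℤ.≤ ∑ E
term≤∑ {suc m} E E≥0 Fin.zero =
  ℤP.i≤i+j (E Fin.zero) _ {{ℤ.nonNegative (∑-nonneg (E ∘ Fin.suc) (E≥0 ∘ Fin.suc))}}
term≤∑ {suc m} E E≥0 (Fin.suc k) =
  ℤP.≤-trans (term≤∑ (E ∘ Fin.suc) (E≥0 ∘ Fin.suc) k) (ℤP.i≤j+i _ _ {{ℤ.nonNegative (E≥0 Fin.zero)}})

term+term≤∑ : ∀ {m} (E : Fin m → ℤ) → (∀ v → + 0 ℤ.≤ E v) →
              ∀ a b → a ≢ b → E a + E b ℤ.≤ ∑ E
term+term≤∑ {suc m} E E≥0 Fin.zero Fin.zero a≢b = contradiction refl a≢b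
term+term≤∑ {suc m} E E≥0 Fin.zero (Fin.suc b) _ =
  ℤP.+-monoʳ-≤ (E Fin.zero) (term≤∑ (E ∘ Fin.suc) (E≥0 ∘ Fin.suc) b)
term+term≤∑ {suc m} E E≥0 (Fin.suc a) Fin.zero _ =
  subst (ℤ._≤ ∑ E) (ℤP.+-comm (E Fin.zero) _)
        (ℤP.+-monoʳ-≤ (E Fin.zero) (term≤∑ (E ∘ Fin.suc) (E≥0 ∘ Fin.suc) a))
term+term≤∑ {suc m} E E≥0 (Fin.suc a) (Fin.suc b) a≢b =
  ℤP.≤-trans (term+term≤∑ (E ∘ Fin.suc) (E≥0 ∘ Fin.suc) a b (a≢b ∘ cong Fin.suc))
             (ℤP.i≤j+i _ _ {{ℤ.nonNegative (E≥0 Fin.zero)}})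

nonneg⇒0⊎pos : ∀ {x} → + 0 ℤ.≤ x → x ≡ + 0 ⊎ + 1 ℤ.≤ x
nonneg⇒0⊎pos {+ zero}  _ = inj₁ refl
nonneg⇒0⊎pos {+ suc _} _ = inj₂ (+≤+ (ℕ.s≤s ℕ.z≤n))

nonneg∧∑≤1⇒zero⊎point : ∀ {m} (E : Fin m → ℤ) → (∀ v → + 0 ℤ.≤ E v) → ∑ E ℤ.≤ + 1 →
                         (∀ v → E v ≡ + 0) ⊎ ∃ λ k → E k ≡ + 1 × (∀ v → v ≢ k → E v ≡ + 0)
nonneg∧∑≤1⇒zero⊎point E E≥0 ∑E≤1 with FinP.any? (λ w → + 1 ℤP.≤? E w)
... | no ∄pos = inj₁ λ v → [ id , (λ 1≤Ev → contradiction (v , 1≤Ev) ∄pos) ]′ (nonneg⇒0⊎pos (E≥0 v))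
... | yes (k , 1≤Ek) = inj₂ (k , Ek≡1 , off-k)
  where
  Ek≡1 : E k ≡ + 1
  Ek≡1 = ℤP.≤-antisym (ℤP.≤-trans (term≤∑ E E≥0 k) ∑E≤1) 1≤Ek
  2≰1 : ¬ (+ 2 ℤ.≤ + 1)
  2≰1 (+≤+ (ℕ.s≤s ()))
  off-k : ∀ v → v ≢ k → E v ≡ + 0
  off-k v v≢k with nonneg⇒0⊎pos (E≥0 v)
  ... | inj₁ Ev≡0 = Ev≡0
  ... | inj₂ 1≤Ev = contradiction 2≤1 2≰1
    where
    2≤1 : + 2 ℤ.≤ + 1
    2≤1 = ℤP.≤-trans (ℤP.+-mono-≤ 1≤Ek 1≤Ev) (ℤP.≤-trans (term+term≤∑ E E≥0 k v (v≢k ∘ sym)) ∑E≤1)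

lcm-pos : ∀ {a b} → 0 < a → 0 < b → 0 < lcm a b
lcm-pos {a} {b} 0<a 0<b = ℕP.n≢0⇒n>0 λ lcm≡0 →
  [ ℕP.n>0⇒n≢0 0<a , ℕP.n>0⇒n≢0 0<b ]′ (ℕP.m*n≡0⇒m≡0∨n≡0 a (begin
    a ℕ.* b               ≡⟨ gcd*lcm a b ⟨
    gcd a b ℕ.* lcm a b   ≡⟨ cong (gcd a b ℕ.*_) lcm≡0 ⟩
    gcd a b ℕ.* 0         ≡⟨ ℕP.*-zeroʳ (gcd a b) ⟩
    0                     ∎))
  where open ≡-Reasoning

lcmAll-pos : ∀ {s} (A : Fin s → ℕ) → (∀ j → 0 < A j) → 0 < lcmAll A
lcmAll-pos {zero}  A A>0 = ℕ.s≤s ℕ.z≤n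
lcmAll-pos {suc s} A A>0 = lcm-pos (A>0 Fin.zero) (lcmAll-pos (A ∘ Fin.suc) (A>0 ∘ Fin.suc))

∣lcmAll : ∀ {s} (A : Fin s → ℕ) i → A i ∣ lcmAll A
∣lcmAll {suc s} A Fin.zero    = m∣lcm[m,n] _ _
∣lcmAll {suc s} A (Fin.suc i) = ∣-trans (∣lcmAll (A ∘ Fin.suc) i) (n∣lcm[m,n] (A Fin.zero) _)

chips : ∀ {m} → ℕ → ℕ → Fin m → ℤ
chips c k v = + (if does (toℕ v ℕ.≟ k) then c else 0)

chips-at : ∀ {m k} c (v : Fin m) → toℕ v ≡ k → chips c k v ≡ + c
chips-at {k = k} c v v≡k rewrite dec-true (toℕ v ℕ.≟ k) v≡k = refl

chips-off : ∀ {m k} c (v : Fin m) → toℕ v ≢ k → chips c k v ≡ + 0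
chips-off {k = k} c v v≢k rewrite dec-false (toℕ v ℕ.≟ k) v≢k = refl

chips-nonneg : ∀ {m c k} (v : Fin m) → + 0 ℤ.≤ chips c k v
chips-nonneg _ = +≤+ ℕ.z≤n

∑-chips : ∀ {m} c (u : Fin m) → ∑ {m} (chips c (toℕ u)) ≡ + c
∑-chips c u = trans (∑-single (chips c (toℕ u)) u (λ w w≢u → chips-off c w (w≢u ∘ FinP.toℕ-injective)))
                    (chips-at c u refl)

edgeTerm-zero : ∀ a x y → a ≡ 0 ⊎ x ≡ y → + a * (x - y) ≡ + 0
edgeTerm-zero .0 x y  (inj₁ refl) = refl
edgeTerm-zero a  x .x (inj₂ refl) = trans (cong (+ a *_) (ℤP.+-inverseʳ x)) (ℤP.*-zeroʳ (+ a))

module _ (G : Multigraph) where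

  laplacian-flat : ∀ f v → (∀ w → mult G v w ≡ 0 ⊎ f v ≡ f w) → laplacian G f v ≡ + 0
  laplacian-flat f v flat = ∑-zero (λ w → edgeTerm-zero _ _ _ (flat w))

  laplacian-one-neighbour : ∀ f v w₀ → (∀ w → w ≢ w₀ → mult G v w ≡ 0 ⊎ f v ≡ f w) →
                            laplacian G f v ≡ + mult G v w₀ * (f v - f w₀)
  laplacian-one-neighbour f v w₀ flat =
    ∑-single (λ w → + mult G v w * (f v - f w)) w₀ (λ w w≢w₀ → edgeTerm-zero _ _ _ (flat w w≢w₀))

  laplacian-+ : ∀ f g v → laplacian G (λ w → f w + g w) v ≡ laplacian G f v + laplacian G g v
  laplacian-+ f g v =
    trans (∑-cong (λ w → distrib (+ mult G v w) (f v) (f w) (g v) (g w)))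
          (∑-+ (λ w → + mult G v w * (f v - f w)) (λ w → + mult G v w * (g v - g w)))
    where
    distrib : ∀ a b c d e → a * ((b + d) - (c + e)) ≡ a * (b - c) + a * (d - e)
    distrib = solve-∀

  ∼-of-laplacian : ∀ {D D'} f → (∀ v → laplacian G f v ≡ D v - D' v) → _∼_ {G} D D'
  ∼-of-laplacian {D} {D'} f Lf≡D-D' = f , λ v →
    sym (trans (cong (_-_ (D v)) (Lf≡D-D' v)) (cancel (D v) (D' v)))
    where
    cancel : ∀ x y → x - (x - y) ≡ y
    cancel = solve-∀

  ∼-reflexive : ∀ {D D'} → (∀ v → D v ≡ D' v) → _∼_ {G} D D'
  ∼-reflexive {D} {D'} D≗D' = ∼-of-laplacian {D} {D'} (λ _ → + 0) λ v →
    trans (laplacian-flat (λ _ → + 0) v (λ _ → inj₂ refl))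
          (sym (trans (cong (_- D' v) (D≗D' v)) (ℤP.+-inverseʳ (D' v))))

  ∼-trans : ∀ {D D' D''} → _∼_ {G} D D' → _∼_ {G} D' D'' → _∼_ {G} D D''
  ∼-trans {D} {D'} {D''} (f , D'≡) (g , D''≡) = (λ w → f w + g w) , λ v → begin
    D'' v                                           ≡⟨ D''≡ v ⟩
    D' v - laplacian G g v                          ≡⟨ cong (_- laplacian G g v) (D'≡ v) ⟩
    (D v - laplacian G f v) - laplacian G g v       ≡⟨ sub-sub (D v) _ _ ⟩
    D v - (laplacian G f v + laplacian G g v)       ≡⟨ cong (_-_ (D v)) (laplacian-+ f g v) ⟨
    D v - laplacian G (λ w → f w + g w) v           ∎
    where
    open ≡-Reasoning
    sub-sub : ∀ x y z → (x - y) - z ≡ x - (y + z)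
    sub-sub = solve-∀

  ∼-minus : ∀ {D D'} (E : Divisor G) → _∼_ {G} D D' →
            _∼_ {G} (λ v → D v - E v) (λ v → D' v - E v)
  ∼-minus {D} E (f , D'≡) = f , λ v →
    trans (cong (_- E v) (D'≡ v)) (swap (D v) (laplacian G f v) (E v))
    where
    swap : ∀ x y z → (x - y) - z ≡ (x - z) - y
    swap = solve-∀

  rank≥1-if-every-vertex-reachable :
    ∀ D → Effective {G} D →
    (∀ k → ∃ λ D' → _∼_ {G} D D' × Effective {G} D' × + 1 ℤ.≤ D' k) →
    RankAtLeast G 1 D
  rank≥1-if-every-vertex-reachable D D≥0 reach E E≥0 degE≤1
    with nonneg∧∑≤1⇒zero⊎point E E≥0 degE≤1
  ... | inj₁ E≡0 =
    D , ∼-reflexive (λ v → trans (cong (_-_ (D v)) (E≡0 v)) (ℤP.+-identityʳ (D v))) , D≥0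
  ... | inj₂ (k , Ek≡1 , E≡0-off-k) with reach k
  ... | D' , D∼D' , D'≥0 , 1≤D'k = (λ v → D' v - E v) , ∼-minus {D} {D'} E D∼D' , D'-E≥0
    where
    D'-E≥0 : Effective {G} (λ v → D' v - E v)
    D'-E≥0 v with v Fin.≟ k
    ... | yes refl = subst (λ x → + 0 ℤ.≤ D' k - x) (sym Ek≡1) (ℤP.i≤j⇒0≤j-i 1≤D'k)
    ... | no v≢k   = subst (λ x → + 0 ℤ.≤ D' v - x) (sym (E≡0-off-k v v≢k))
                           (subst (+ 0 ℤ.≤_) (sym (ℤP.+-identityʳ (D' v))) (D'≥0 v))

module BananaPath (s : ℕ) {{_ : NonZero s}} (A : Fin s → ℕ) (n : ℕ) where

  G : Multigraph
  G = banana s A n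

  V : Set
  V = Fin (suc n)

  L : ℕ
  L = lcmAll A

  edge-or-0 : ∀ u w → mult G u w ≡ 0 ⊎ toℕ w ≡ suc (toℕ u) ⊎ toℕ u ≡ suc (toℕ w)
  edge-or-0 u w with toℕ w ℕ.≟ suc (toℕ u) | toℕ u ℕ.≟ suc (toℕ w)
  ... | yes up | _       = inj₂ (inj₁ up)
  ... | no _   | yes down = inj₂ (inj₂ down)
  ... | no _   | no _     = inj₁ refl

  mult-up : ∀ u w → toℕ w ≡ suc (toℕ u) → mult G u w ≡ A (toℕ u mod s)
  mult-up u w up with toℕ w ℕ.≟ suc (toℕ u)
  ... | yes _  = refl
  ... | no ¬up = contradiction up ¬up

  mult-down : ∀ u w → toℕ u ≡ suc (toℕ w) → mult G u w ≡ A (toℕ w mod s)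
  mult-down u w down with toℕ w ℕ.≟ suc (toℕ u) | toℕ u ℕ.≟ suc (toℕ w)
  ... | yes up | _        = contradiction (trans up (cong suc down))
                                          (ℕP.<⇒≢ (ℕP.m<n⇒m<1+n (ℕP.n<1+n (toℕ w))))
  ... | no _   | yes _    = refl
  ... | no _   | no ¬down = contradiction down ¬down

  c : ℕ → ℕ
  c j = quotient (∣lcmAll A (j mod s))

  L≡c*A : ∀ j → L ≡ c j ℕ.* A (j mod s)
  L≡c*A j = m∣n⇒n≡quotient*m (∣lcmAll A (j mod s))

  fireUpTo : ℕ → V → ℤ
  fireUpTo j w = + (if does (toℕ w ℕ.≤? j) then c j else 0)

  fireUpTo-≤ : ∀ {j} w → toℕ w ℕ.≤ j → fireUpTo j w ≡ + c j
  fireUpTo-≤ {j} w w≤j rewrite dec-true (toℕ w ℕ.≤? j) w≤j = refl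

  fireUpTo-> : ∀ {j} w → j < toℕ w → fireUpTo j w ≡ + 0
  fireUpTo->  {j} w j<w rewrite dec-false (toℕ w ℕ.≤? j) (ℕP.<⇒≱ j<w) = refl

  fireUpTo-flat : ∀ {j} u w → toℕ w ≡ suc (toℕ u) → toℕ u ≢ j → fireUpTo j u ≡ fireUpTo j w
  fireUpTo-flat {j} u w up u≢j with ℕP.≤-<-connex (toℕ u) j
  ... | inj₁ u≤j = trans (fireUpTo-≤ u u≤j)
                         (sym (fireUpTo-≤ w (subst (ℕ._≤ j) (sym up) (ℕP.≤∧≢⇒< u≤j u≢j))))
  ... | inj₂ j<u = trans (fireUpTo-> u j<u)
                         (sym (fireUpTo-> w (subst (j <_) (sym up) (ℕP.m<n⇒m<1+n j<u))))

  fireUpTo-flat-off-cut : ∀ {j} u w → (toℕ w ≡ suc (toℕ u) → toℕ u ≢ j) →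
                          (toℕ u ≡ suc (toℕ w) → toℕ w ≢ j) →
                          mult G u w ≡ 0 ⊎ fireUpTo j u ≡ fireUpTo j w
  fireUpTo-flat-off-cut u w up⇒ down⇒ with edge-or-0 u w
  ... | inj₁ m≡0         = inj₁ m≡0
  ... | inj₂ (inj₁ up)   = inj₂ (fireUpTo-flat u w up (up⇒ up))
  ... | inj₂ (inj₂ down) = inj₂ (sym (fireUpTo-flat w u down (down⇒ down)))

  laplacian-fireUpTo-at-j : ∀ {j} → j < n → ∀ v → toℕ v ≡ j → laplacian G (fireUpTo j) v ≡ + L
  laplacian-fireUpTo-at-j {j} j<n v v≡j = begin
    laplacian G (fireUpTo j) v                      ≡⟨ laplacian-one-neighbour G (fireUpTo j) v w₀ flat ⟩
    + mult G v w₀ * (fireUpTo j v - fireUpTo j w₀)  ≡⟨ cong₂ (λ a x → + a * x) mult≡A values ⟩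
    + A (j mod s) * (+ c j - + 0)                   ≡⟨ outflow (+ A (j mod s)) (+ c j) ⟩
    + c j * + A (j mod s)                           ≡⟨ ℤP.pos-* (c j) _ ⟨
    + (c j ℕ.* A (j mod s))                         ≡⟨ cong +_ (L≡c*A j) ⟨
    + L                                             ∎
    where
    open ≡-Reasoning
    w₀ : V
    w₀ = fromℕ< (ℕ.s≤s j<n)
    toℕw₀ : toℕ w₀ ≡ suc j
    toℕw₀ = FinP.toℕ-fromℕ< (ℕ.s≤s j<n)
    mult≡A : mult G v w₀ ≡ A (j mod s)
    mult≡A = trans (mult-up v w₀ (trans toℕw₀ (cong suc (sym v≡j)))) (cong (λ i → A (i mod s)) v≡j)
    values : fireUpTo j v - fireUpTo j w₀ ≡ + c j - + 0
    values = cong₂ _-_ (fireUpTo-≤ v (ℕP.≤-reflexive v≡j)) (fireUpTo-> w₀ (ℕP.≤-reflexive (sym toℕw₀)))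
    outflow : ∀ a x → a * (x - + 0) ≡ x * a
    outflow = solve-∀
    flat : ∀ w → w ≢ w₀ → mult G v w ≡ 0 ⊎ fireUpTo j v ≡ fireUpTo j w
    flat w w≢w₀ = fireUpTo-flat-off-cut v w
      (λ up → contradiction (FinP.toℕ-injective (trans up (trans (cong suc v≡j) (sym toℕw₀)))) w≢w₀)
      (λ down w≡j → ℕP.1+n≢n (trans (sym (trans down (cong suc w≡j))) v≡j))

  laplacian-fireUpTo-at-suc-j : ∀ {j} → j < n → ∀ v → toℕ v ≡ suc j →
                                laplacian G (fireUpTo j) v ≡ - + L
  laplacian-fireUpTo-at-suc-j {j} j<n v v≡1+j = begin
    laplacian G (fireUpTo j) v                      ≡⟨ laplacian-one-neighbour G (fireUpTo j) v w₀ flat ⟩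
    + mult G v w₀ * (fireUpTo j v - fireUpTo j w₀)  ≡⟨ cong₂ (λ a x → + a * x) mult≡A values ⟩
    + A (j mod s) * (+ 0 - + c j)                   ≡⟨ inflow (+ A (j mod s)) (+ c j) ⟩
    - (+ c j * + A (j mod s))                       ≡⟨ cong -_ (ℤP.pos-* (c j) _) ⟨
    - + (c j ℕ.* A (j mod s))                       ≡⟨ cong (-_ ∘ +_) (L≡c*A j) ⟨
    - + L                                           ∎
    where
    open ≡-Reasoning
    j<1+n : j < suc n
    j<1+n = ℕP.m<n⇒m<1+n j<n
    w₀ : V
    w₀ = fromℕ< j<1+n
    toℕw₀ : toℕ w₀ ≡ j
    toℕw₀ = FinP.toℕ-fromℕ< j<1+n
    mult≡A : mult G v w₀ ≡ A (j mod s)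
    mult≡A = trans (mult-down v w₀ (trans v≡1+j (cong suc (sym toℕw₀)))) (cong (λ i → A (i mod s)) toℕw₀)
    values : fireUpTo j v - fireUpTo j w₀ ≡ + 0 - + c j
    values = cong₂ _-_ (fireUpTo-> v (ℕP.≤-reflexive (sym v≡1+j))) (fireUpTo-≤ w₀ (ℕP.≤-reflexive toℕw₀))
    inflow : ∀ a x → a * (+ 0 - x) ≡ - (x * a)
    inflow = solve-∀
    flat : ∀ w → w ≢ w₀ → mult G v w ≡ 0 ⊎ fireUpTo j v ≡ fireUpTo j w
    flat w w≢w₀ = fireUpTo-flat-off-cut v w
      (λ _ v≡j → ℕP.1+n≢n (trans (sym v≡1+j) v≡j))
      (λ down → contradiction
        (FinP.toℕ-injective (trans (ℕP.suc-injective (trans (sym down) v≡1+j)) (sym toℕw₀))) w≢w₀)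

  laplacian-fireUpTo-off-cut : ∀ {j} v → toℕ v ≢ j → toℕ v ≢ suc j → laplacian G (fireUpTo j) v ≡ + 0
  laplacian-fireUpTo-off-cut {j} v v≢j v≢1+j = laplacian-flat G (fireUpTo j) v λ w →
    fireUpTo-flat-off-cut v w (λ _ → v≢j) (λ down w≡j → v≢1+j (trans down (cong suc w≡j)))

  laplacian-fireUpTo : ∀ {j} → j < n → ∀ v → laplacian G (fireUpTo j) v ≡ chips L j v - chips L (suc j) v
  laplacian-fireUpTo {j} j<n v with toℕ v ℕ.≟ j | toℕ v ℕ.≟ suc j
  ... | yes v≡j | _ = begin
    laplacian G (fireUpTo j) v          ≡⟨ laplacian-fireUpTo-at-j j<n v v≡j ⟩
    + L                                 ≡⟨ ℤP.+-identityʳ (+ L) ⟨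
    + L - + 0                           ≡⟨ cong₂ _-_ (chips-at L v v≡j) (chips-off L v v≢1+j) ⟨
    chips L j v - chips L (suc j) v     ∎
    where
    open ≡-Reasoning
    v≢1+j : toℕ v ≢ suc j
    v≢1+j v≡1+j = ℕP.1+n≢n (trans (sym v≡1+j) v≡j)
  ... | no v≢j | yes v≡1+j = begin
    laplacian G (fireUpTo j) v          ≡⟨ laplacian-fireUpTo-at-suc-j j<n v v≡1+j ⟩
    - + L                               ≡⟨ ℤP.+-identityˡ (- + L) ⟨
    + 0 - + L                           ≡⟨ cong₂ _-_ (chips-off L v v≢j) (chips-at L v v≡1+j) ⟨
    chips L j v - chips L (suc j) v     ∎
    where open ≡-Reasoning
  ... | no v≢j | no v≢1+j = begin
    laplacian G (fireUpTo j) v          ≡⟨ laplacian-fireUpTo-off-cut v v≢j v≢1+j ⟩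
    + 0 - + 0                           ≡⟨ cong₂ _-_ (chips-off L v v≢j) (chips-off L v v≢1+j) ⟨
    chips L j v - chips L (suc j) v     ∎
    where open ≡-Reasoning

  chips-step : ∀ {j} → j < n → _∼_ {G} (chips L j) (chips L (suc j))
  chips-step {j} j<n = ∼-of-laplacian G {chips L j} {chips L (suc j)} (fireUpTo j) (laplacian-fireUpTo j<n)

  chips-0∼chips : ∀ k → k ℕ.≤ n → _∼_ {G} (chips L 0) (chips L k)
  chips-0∼chips zero    _   = ∼-reflexive G {chips L 0} {chips L 0} (λ _ → refl)
  chips-0∼chips (suc k) k<n =
    ∼-trans G {chips L 0} {chips L k} {chips L (suc k)} (chips-0∼chips k (ℕP.<⇒≤ k<n)) (chips-step k<n)

corollary2p7 : (s : ℕ) {{_ : NonZero s}} (A : Fin s → ℕ) → (∀ j → 0 < A j) →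
               (n : ℕ) → GonalityAtMost (banana s A n) (lcmAll A)
corollary2p7 s A A>0 n =
  chips L 0 , ℤP.≤-reflexive (∑-chips L (Fin.zero {n})) ,
  rank≥1-if-every-vertex-reachable G (chips L 0) chips-nonneg reach
  where
  open BananaPath s A n
  reach : ∀ k → ∃ λ D' → _∼_ {G} (chips L 0) D' × Effective {G} D' × + 1 ℤ.≤ D' k
  reach k = chips L (toℕ k) , chips-0∼chips (toℕ k) (FinP.toℕ≤pred[n] k) , chips-nonneg ,
            subst (+ 1 ℤ.≤_) (sym (chips-at L k refl)) (+≤+ (lcmAll-pos A A>0))
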